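{- Let $a,b$ be relatively prime integers with $1<a<b$ and $S=\langle a,b\rangle$. Let $x\in I(S)$. If $n$ is the smallest positive integer such that $x+na\in S$, then $x+na\in b\mathbb{N}$.
   Context: $\langle a,b\rangle=\{\lambda_1a+\lambda_2b:\lambda_1,\lambda_2\in\mathbb{N}\}$, $\mathbb{N}$ the nonnegative integers, $b\mathbb{N}=\{bk:k\in\mathbb{N}\}$. $I(S)$ is the set of isolated gaps of $S$ (elements $x\in\mathbb{N}\setminus S$ with $x-1,x+1\in S$). -}

module Defs where

open import Data.Nat using (ℕ; zero; suc; _+_; _*_; _<_; _≤_)
open import Data.Product using (Σ; ∃; _×_; _,_)
open import Relation.Binary.PropositionalEquality using (_≡_)
open import Relation.Nullary using (¬_)

_∈⟨_,_⟩ : ℕ → ℕ → ℕ → Set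
x ∈⟨ a , b ⟩ = ∃ λ l₁ → ∃ λ l₂ → l₁ * a + l₂ * b ≡ x

_∈_ℕ : ℕ → ℕ → Set
x ∈ b ℕ = ∃ λ k → b * k ≡ x

-- x is an isolated gap of ⟨a,b⟩: x ∉ S, x-1 ∈ S, x+1 ∈ S.
-- (x-1 ∈ S requires x ≥ 1, so x = suc y with y ∈ S.)
IsolatedGap : ℕ → ℕ → ℕ → Set
IsolatedGap a b x =
  ¬ (x ∈⟨ a , b ⟩) × (∃ λ y → suc y ≡ x × y ∈⟨ a , b ⟩) × (suc x ∈⟨ a , b ⟩)

IsLeastPosShift : ℕ → ℕ → ℕ → ℕ → Set
IsLeastPosShift a b x n =
  0 < n × (x + n * a) ∈⟨ a , b ⟩ ×
  (∀ m → 0 < m → m < n → ¬ ((x + m * a) ∈⟨ a , b ⟩))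

{-# OPTIONS --safe #-}
-- Write x + n a = l₁ a + l₂ b.  If l₁ > 0, one copy of a can be removed from
-- both sides, so x + (n - 1) a ∈ S: this is x itself when n = 1 (but x is a
-- gap) and contradicts the minimality of n otherwise.  Hence l₁ = 0.
module Submission where

open import Defs
open import Data.Nat using (ℕ; zero; suc; _+_; _*_; _<_; s≤s; z≤n)
open import Data.Nat.Properties
  using (+-assoc; *-comm; +-cancelˡ-≡; +-identityʳ; n<1+n; +-commutativeSemigroup)
open import Algebra.Properties.CommutativeSemigroup +-commutativeSemigroup
  using (x∙yz≈y∙xz)
open import Data.Nat.GCD using (gcd)
open import Data.Product using (_,_)
open import Data.Sum using (_⊎_; inj₁; inj₂)
open import Function using (_∘_)
open import Relation.Nullary using (¬_; contradiction)
open import Relation.Binary.PropositionalEquality using (_≡_; refl; sym; trans; subst)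

∈⟨⟩-strip-a : ∀ {a b y z} → a + y ≡ z → z ∈⟨ a , b ⟩ → z ∈ b ℕ ⊎ y ∈⟨ a , b ⟩
∈⟨⟩-strip-a {b = b} refl (zero , l₂ , eq) = inj₁ (l₂ , trans (*-comm b l₂) eq)
∈⟨⟩-strip-a {a} {b} refl (suc l₁ , l₂ , eq) =
  inj₂ (l₁ , l₂ , +-cancelˡ-≡ a _ _ (trans (sym (+-assoc a (l₁ * a) (l₂ * b))) eq))

shift-before-least-∉ : ∀ {a b x m} → ¬ x ∈⟨ a , b ⟩ →
  IsLeastPosShift a b x (suc m) → ¬ (x + m * a) ∈⟨ a , b ⟩
shift-before-least-∉ {a} {b} {x} {zero} x∉S _ =
  x∉S ∘ subst (_∈⟨ a , b ⟩) (+-identityʳ x)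
shift-before-least-∉ {m = suc j} _ (_ , _ , minimal) =
  minimal (suc j) (s≤s z≤n) (n<1+n (suc j))

lemma4p5 : (a b x n : ℕ) → gcd a b ≡ 1 → 1 < a → a < b →
    IsolatedGap a b x → IsLeastPosShift a b x n →
    (x + n * a) ∈ b ℕ
lemma4p5 a b x zero _ _ _ _ (() , _)
lemma4p5 a b x (suc m) _ _ _ (x∉S , _) least@(_ , x+na∈S , _)
  with ∈⟨⟩-strip-a (sym (x∙yz≈y∙xz x a (m * a))) x+na∈S
... | inj₁ x+na∈bℕ = x+na∈bℕ
... | inj₂ x+ma∈S  = contradiction x+ma∈S (shift-before-least-∉ x∉S least)
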